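{- For non-constant Boolean functions $f:\{0,1\}^n\to\{0,1\}$ and $g:\{0,1\}^m\to\{0,1\}$, $$\mathrm{Depth}(f)\,(\mathrm{Rank}(g)-1)+1\le \mathrm{Rank}(f\circ g)\le \mathrm{Depth}(f)\,\mathrm{Rank}(g).$$ Both inequalities are tight: the first for $\mathrm{AND}_n\circ\mathrm{PARITY}_m$, and the second for $\mathrm{TRIBES}_n=\mathrm{OR}_n\circ\mathrm{AND}_n$ and its dual $\mathrm{TRIBES}^d_n=\mathrm{AND}_n\circ\mathrm{OR}_n$.
   Context: A decision tree computes a Boolean function by querying one variable per internal node, with leaves labelled $0/1$. $\mathrm{Depth}(f)$ is the minimum depth of a decision tree computing $f$. The rank of a rooted binary tree: leaves have rank $0$; an internal node with children of ranks $a,b$ has rank $a+1$ if $a=b$, else $\max\{a,b\}$. $\mathrm{Rank}(f)$ is the minimum rank of a decision tree computing $f$. The composition $f\circ g:\{0,1\}^{nm}\to\{0,1\}$ is $(f\circ g)(a^1,\dots,a^n)=f(g(a^1),\dots,g(a^n))$ for $a^i\in\{0,1\}^m$. $\mathrm{PARITY}_m$ is XOR of $m$ bits. -}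

module Defs where

open import Data.Nat using (ℕ; zero; suc; _+_; _*_; _∸_; _≤_; _⊔_)
open import Data.Nat as ℕ using ()
open import Data.Bool using (Bool; true; false; _∧_; _∨_; _xor_)
open import Data.Fin using (Fin; combine) renaming (zero to fzero; suc to fsuc)
open import Data.Product using (Σ; ∃; _×_; _,_)
open import Relation.Binary.PropositionalEquality using (_≡_; _≢_)
open import Relation.Nullary using (Dec; yes; no)

-- Boolean functions on n bits; input is an assignment Fin n → Bool
-- (false = 0, true = 1).
BoolFun : ℕ → Set
BoolFun n = (Fin n → Bool) → Bool

NonConstant : ∀ {n} → BoolFun n → Set
NonConstant {n} f = Σ (Fin n → Bool) λ x → Σ (Fin n → Bool) λ y → f x ≢ f y

data DTree (n : ℕ) : Set where
  leaf : Bool → DTree n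
  node : Fin n → DTree n → DTree n → DTree n

eval : ∀ {n} → DTree n → (Fin n → Bool) → Bool
eval (leaf b) x = b
eval (node i t₀ t₁) x with x i
... | false = eval t₀ x
... | true  = eval t₁ x

depth : ∀ {n} → DTree n → ℕ
depth (leaf _) = 0
depth (node _ t₀ t₁) = suc (depth t₀ ⊔ depth t₁)

rank : ∀ {n} → DTree n → ℕ
rank (leaf _) = 0
rank (node _ t₀ t₁) with rank t₀ ℕ.≟ rank t₁
... | yes _ = suc (rank t₀)
... | no  _ = rank t₀ ⊔ rank t₁

Computes : ∀ {n} → DTree n → BoolFun n → Set
Computes {n} t f = (x : Fin n → Bool) → eval t x ≡ f x

IsDepth : ∀ {n} → BoolFun n → ℕ → Set
IsDepth {n} f d =
  (Σ (DTree n) λ t → Computes t f × depth t ≡ d) ×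
  ((t : DTree n) → Computes t f → d ≤ depth t)

IsRank : ∀ {n} → BoolFun n → ℕ → Set
IsRank {n} f r =
  (Σ (DTree n) λ t → Computes t f × rank t ≡ r) ×
  ((t : DTree n) → Computes t f → r ≤ rank t)

-- Composition f ∘ g on n*m bits; block i consists of the variables
-- combine i j (j : Fin m), i.e. index i*m + j.
compose : ∀ {n m} → BoolFun n → BoolFun m → BoolFun (n * m)
compose {n} {m} f g x = f (λ i → g (λ j → x (combine i j)))

AND : ∀ n → BoolFun n
AND zero    x = true
AND (suc n) x = x fzero ∧ AND n (λ i → x (fsuc i))

OR : ∀ n → BoolFun n
OR zero    x = false
OR (suc n) x = x fzero ∨ OR n (λ i → x (fsuc i))

PARITY : ∀ m → BoolFun m
PARITY zero    x = false
PARITY (suc m) x = x fzero xor PARITY m (λ i → x (fsuc i))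

TRIBES : ∀ n → BoolFun (n * n)
TRIBES n = compose (OR n) (AND n)

TRIBESᵈ : ∀ n → BoolFun (n * n)
TRIBESᵈ n = compose (AND n) (OR n)

{-# OPTIONS --safe #-}
-- Upper bound: in a depth-d tree for f, replace every query of a variable j by a
-- rank-r tree for g on block j. Grafting trees of rank at most K onto the leaves of a
-- tree raises its rank by at most K, so the result has rank at most d r.
--
-- Lower bound: an adversary walks down a tree T for f ∘ g while building a tree S for f.
-- Block j carries a budget, initially Rank(g) - 1, and is kept in a state where g still
-- needs rank budget + 1. A query in block j is answered so as to preserve this, and if
-- both answers break it the adversary follows the lighter branch of T and lowers the
-- budget, so every unit of budget spent is paid for by a unit of rank of T. Once a budget
-- is exhausted and the two answers fix g to different values, S queries the variable j
-- of f and both branches are followed. Thus rank T ≥ 1 + (Rank(g) - 1) · depth S, and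
-- depth S ≥ Depth(f).
--
-- Tightness: Rank(PARITY_m) = m and AND_n ∘ PARITY_m has an explicit tree of rank
-- n (m - 1) + 1. For TRIBES_n, a potential counting the blocks with no zero and two free
-- variables drops by at most one per unit of rank, so Rank(TRIBES_n) ≥ n; TRIBES^d_n is
-- the dual function.

module Submission where

open import Defs
open import Data.Bool using (Bool; true; false; not; _∧_; _xor_; if_then_else_)
open import Data.Bool.Properties using (not-involutive; not-¬; ¬-not; not-distribˡ-xor; not-distribʳ-xor)
open import Data.Empty using (⊥; ⊥-elim)
open import Data.Fin using (Fin; combine; remQuot) renaming (zero to fzero; suc to fsuc)
open import Data.Fin as Fin using ()
open import Data.Fin.Properties using (remQuot-combine; combine-remQuot)
open import Data.Maybe using (Maybe; just; nothing; fromMaybe)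
open import Data.Maybe.Properties using (just-injective)
open import Data.Nat using (ℕ; zero; suc; _+_; _*_; _∸_; _≤_; _<_; _⊔_; _⊓_; z≤n; s≤s; _≤?_; _≟_)
open import Data.Nat.Properties
open import Data.Product using (Σ; _×_; _,_; proj₁; proj₂; uncurry)
open import Data.Sum using (_⊎_; inj₁; inj₂)
open import Data.Vec.Functional using (updateAt)
open import Data.Vec.Functional.Properties using (updateAt-updates; updateAt-minimal)
open import Effect.Monad using (RawMonad)
open import Function using (_∘_; id; const)
open import Level using (0ℓ)
open import Relation.Binary.Definitions using (tri<; tri≈; tri>)
open import Relation.Binary.PropositionalEquality
  using (_≡_; _≢_; refl; sym; trans; cong; cong₂; subst; subst₂; module ≡-Reasoning)
open import Relation.Nullary using (¬_; yes; no)
open import Relation.Nullary.Decidable using (decidable-stable)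
open import Relation.Nullary.Negation using (DoubleNegation; ¬¬-Monad)

open RawMonad (¬¬-Monad {0ℓ}) using (pure; _>>=_)

¬¬-Π-Fin : ∀ {n} {P : Fin n → Set} → (∀ j → DoubleNegation (P j)) → DoubleNegation (∀ j → P j)
¬¬-Π-Fin {zero}      _   ¬all = ¬all λ ()
¬¬-Π-Fin {suc n} {P} ¬¬P ¬all =
  ¬¬P fzero λ P₀ → ¬¬-Π-Fin {P = P ∘ fsuc} (¬¬P ∘ fsuc) λ P₊ → ¬all λ { fzero → P₀ ; (fsuc j) → P₊ j }

branch : ∀ {N} → DTree N → DTree N → Bool → DTree N
branch t₀ t₁ b = if b then t₁ else t₀

eval-node : ∀ {N} (i : Fin N) t₀ t₁ x → eval (node i t₀ t₁) x ≡ eval (branch t₀ t₁ (x i)) x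
eval-node i t₀ t₁ x with x i
... | false = refl
... | true  = refl

eval-node-at : ∀ {N} {i : Fin N} {t₀ t₁ x b} → x i ≡ b → eval (node i t₀ t₁) x ≡ eval (branch t₀ t₁ b) x
eval-node-at {i = i} {t₀} {t₁} {x} refl = eval-node i t₀ t₁ x

eval-cong : ∀ {N} (t : DTree N) {x y} → (∀ i → x i ≡ y i) → eval t x ≡ eval t y
eval-cong (leaf b)       x≗y = refl
eval-cong (node i t₀ t₁) {x} {y} x≗y
  rewrite eval-node i t₀ t₁ x | eval-node i t₀ t₁ y | x≗y i with y i
... | false = eval-cong t₀ x≗y
... | true  = eval-cong t₁ x≗y

computes⇒cong : ∀ {N} {h : BoolFun N} (t : DTree N) → Computes t h →
  ∀ {x y} → (∀ i → x i ≡ y i) → h x ≡ h y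
computes⇒cong t t⊢h {x} {y} x≗y = trans (sym (t⊢h x)) (trans (eval-cong t x≗y) (t⊢h y))

joinRank : ℕ → ℕ → ℕ
joinRank a b = (a ⊔ b) ⊔ suc (a ⊓ b)

joinRank-diag : ∀ a → joinRank a a ≡ suc a
joinRank-diag a rewrite ⊔-idem a | ⊓-idem a = m≤n⇒m⊔n≡n (n≤1+n a)

joinRank-distinct : ∀ {a b} → a ≢ b → joinRank a b ≡ a ⊔ b
joinRank-distinct {a} {b} a≢b with <-cmp a b
... | tri< a<b _ _ rewrite m≤n⇒m⊓n≡m (<⇒≤ a<b) = m≥n⇒m⊔n≡m (≤-trans a<b (m≤n⊔m a b))
... | tri≈ _ a≡b _ = ⊥-elim (a≢b a≡b)
... | tri> _ _ a>b rewrite m≥n⇒m⊓n≡n (<⇒≤ a>b) = m≥n⇒m⊔n≡m (≤-trans a>b (m≤m⊔n a b))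

rank-node : ∀ {N} (i : Fin N) t₀ t₁ → rank (node i t₀ t₁) ≡ joinRank (rank t₀) (rank t₁)
rank-node i t₀ t₁ with rank t₀ ≟ rank t₁
... | yes a≡b = sym (trans (cong (joinRank (rank t₀)) (sym a≡b)) (joinRank-diag (rank t₀)))
... | no  a≢b = sym (joinRank-distinct a≢b)

joinRank-≥ˡ : ∀ a b → a ≤ joinRank a b
joinRank-≥ˡ a b = ≤-trans (m≤m⊔n a b) (m≤m⊔n _ _)

joinRank-≥ʳ : ∀ a b → b ≤ joinRank a b
joinRank-≥ʳ a b = ≤-trans (m≤n⊔m a b) (m≤m⊔n _ _)

joinRank-comm : ∀ a b → joinRank a b ≡ joinRank b a
joinRank-comm a b rewrite ⊔-comm a b | ⊓-comm a b = refl

joinRank-mono : ∀ {a a′ b b′} → a ≤ a′ → b ≤ b′ → joinRank a b ≤ joinRank a′ b′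
joinRank-mono a≤a′ b≤b′ = ⊔-mono-≤ (⊔-mono-≤ a≤a′ b≤b′) (s≤s (⊓-mono-≤ a≤a′ b≤b′))

joinRank-+ : ∀ a b k → joinRank (a + k) (b + k) ≡ joinRank a b + k
joinRank-+ a b k
  rewrite sym (+-distribʳ-⊔ k a b) | sym (+-distribʳ-⊓ k a b)
        | +-distribʳ-⊔ k (a ⊔ b) (suc (a ⊓ b)) = refl

joinRank-≤-suc : ∀ a b → joinRank a b ≤ suc (a ⊔ b)
joinRank-≤-suc a b = ⊔-lub (n≤1+n _) (s≤s (≤-trans (m⊓n≤m a b) (m≤m⊔n a b)))

joinRank-≤ : ∀ {a b k} → a ≤ k → b ≤ k → a < k ⊎ b < k → joinRank a b ≤ k
joinRank-≤ {a} {b} a≤k b≤k (inj₁ a<k) = ⊔-lub (⊔-lub a≤k b≤k) (≤-trans (s≤s (m⊓n≤m a b)) a<k)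
joinRank-≤ {a} {b} a≤k b≤k (inj₂ b<k) = ⊔-lub (⊔-lub a≤k b≤k) (≤-trans (s≤s (m⊓n≤n a b)) b<k)

rank-node-pos : ∀ {N} (i : Fin N) t₀ t₁ → 1 ≤ rank (node i t₀ t₁)
rank-node-pos i t₀ t₁ rewrite rank-node i t₀ t₁ = ≤-trans (s≤s z≤n) (m≤n⊔m _ _)

rank-branch≤rank-node : ∀ {N} (i : Fin N) t₀ t₁ b → rank (branch t₀ t₁ b) ≤ rank (node i t₀ t₁)
rank-branch≤rank-node i t₀ t₁ false rewrite rank-node i t₀ t₁ = joinRank-≥ˡ _ _
rank-branch≤rank-node i t₀ t₁ true  rewrite rank-node i t₀ t₁ = joinRank-≥ʳ _ _

lighter-branch : ∀ {N} (i : Fin N) t₀ t₁ → Σ Bool λ b → suc (rank (branch t₀ t₁ b)) ≤ rank (node i t₀ t₁)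
lighter-branch i t₀ t₁ rewrite rank-node i t₀ t₁ with ⊓-sel (rank t₀) (rank t₁)
... | inj₁ e = false , subst (λ c → suc c ≤ joinRank (rank t₀) (rank t₁)) e (m≤n⊔m _ _)
... | inj₂ e = true  , subst (λ c → suc c ≤ joinRank (rank t₀) (rank t₁)) e (m≤n⊔m _ _)

nonConstant-¬leaf : ∀ {N} {h : BoolFun N} {c} → NonConstant h → ¬ Computes (leaf c) h
nonConstant-¬leaf (x , y , hx≢hy) leaf⊢ = hx≢hy (trans (sym (leaf⊢ x)) (leaf⊢ y))

nonConstant⇒rank-pos : ∀ {N} {h : BoolFun N} → NonConstant h → ∀ T → Computes T h → 1 ≤ rank T
nonConstant⇒rank-pos h≠ (leaf c)       T⊢ = ⊥-elim (nonConstant-¬leaf h≠ T⊢)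
nonConstant⇒rank-pos _  (node i T₀ T₁) _  = rank-node-pos i T₀ T₁

-- The upper bound

graft : ∀ {m N} → DTree m → (Fin m → Fin N) → (Bool → DTree N) → DTree N
graft (leaf b)       φ h = h b
graft (node i t₀ t₁) φ h = node (φ i) (graft t₀ φ h) (graft t₁ φ h)

eval-graft : ∀ {m N} (t : DTree m) (φ : Fin m → Fin N) h x →
  eval (graft t φ h) x ≡ eval (h (eval t (x ∘ φ))) x
eval-graft (leaf b) φ h x = refl
eval-graft (node i t₀ t₁) φ h x
  rewrite eval-node (φ i) (graft t₀ φ h) (graft t₁ φ h) x | eval-node i t₀ t₁ (x ∘ φ) with x (φ i)
... | false = eval-graft t₀ φ h x
... | true  = eval-graft t₁ φ h x

rank-graft : ∀ {m N} (t : DTree m) (φ : Fin m → Fin N) h {K} →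
  (∀ b → rank (h b) ≤ K) → rank (graft t φ h) ≤ rank t + K
rank-graft (leaf b)       φ h h≤K = h≤K b
rank-graft (node i t₀ t₁) φ h {K} h≤K
  rewrite rank-node (φ i) (graft t₀ φ h) (graft t₁ φ h) | rank-node i t₀ t₁ =
  ≤-trans (joinRank-mono (rank-graft t₀ φ h h≤K) (rank-graft t₁ φ h h≤K))
          (≤-reflexive (joinRank-+ (rank t₀) (rank t₁) K))

composeTree : ∀ {n m} → DTree m → DTree n → DTree (n * m)
composeTree G (leaf b)       = leaf b
composeTree G (node j S₀ S₁) = graft G (combine j) (branch (composeTree G S₀) (composeTree G S₁))

module _ {n m : ℕ} {g : BoolFun m} {G : DTree m} (G⊢g : Computes G g) where

  eval-composeTree : ∀ (S : DTree n) x →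
    eval (composeTree G S) x ≡ eval S (λ j → g (λ k → x (combine j k)))
  eval-composeTree (leaf b)       x = refl
  eval-composeTree (node j S₀ S₁) x = begin
    eval (graft G (combine j) (branch C₀ C₁)) x  ≡⟨ eval-graft G (combine j) (branch C₀ C₁) x ⟩
    eval (branch C₀ C₁ (eval G (x ∘ combine j))) x ≡⟨ cong (λ b → eval (branch C₀ C₁ b) x) (G⊢g _) ⟩
    eval (branch C₀ C₁ (y j)) x                   ≡⟨ on-branches (y j) ⟩
    eval (branch S₀ S₁ (y j)) y                   ≡⟨ sym (eval-node j S₀ S₁ y) ⟩
    eval (node j S₀ S₁) y                         ∎
    where
    open ≡-Reasoning
    C₀ = composeTree G S₀
    C₁ = composeTree G S₁
    y = λ j → g (λ k → x (combine j k))
    on-branches : ∀ b → eval (branch C₀ C₁ b) x ≡ eval (branch S₀ S₁ b) y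
    on-branches false = eval-composeTree S₀ x
    on-branches true  = eval-composeTree S₁ x

  rank-composeTree : (S : DTree n) → rank (composeTree G S) ≤ depth S * rank G
  rank-composeTree (leaf b)       = z≤n
  rank-composeTree (node j S₀ S₁) = rank-graft G (combine j) _ branch≤
    where
    branch≤ : ∀ b → rank (branch (composeTree G S₀) (composeTree G S₁) b) ≤ (depth S₀ ⊔ depth S₁) * rank G
    branch≤ false = ≤-trans (rank-composeTree S₀) (*-monoˡ-≤ (rank G) (m≤m⊔n (depth S₀) (depth S₁)))
    branch≤ true  = ≤-trans (rank-composeTree S₁) (*-monoˡ-≤ (rank G) (m≤n⊔m (depth S₀) (depth S₁)))

rank-compose≤ : ∀ {n m} {f : BoolFun n} {g : BoolFun m} {d r R} →
  IsDepth f d → IsRank g r → IsRank (compose f g) R → R ≤ d * r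
rank-compose≤ ((S , S⊢f , refl) , _) ((G , G⊢g , refl) , _) (_ , R-min) =
  ≤-trans (R-min (composeTree G S) (λ x → trans (eval-composeTree G⊢g S x) (S⊢f _)))
          (rank-composeTree G⊢g S)

infixl 6 _[_≔_]
infix 4 _⊨_

_[_≔_] : ∀ {m} {A : Set} → (Fin m → A) → Fin m → A → Fin m → A
f [ i ≔ v ] = updateAt f i (const v)

Restriction : ℕ → Set
Restriction m = Fin m → Maybe Bool

unrestricted : ∀ {m} → Restriction m
unrestricted _ = nothing

fix : ∀ {m} → Restriction m → Fin m → Bool → Restriction m
fix τ k b = τ [ k ≔ just b ]

_⊨_ : ∀ {m} → (Fin m → Bool) → Restriction m → Set
x ⊨ τ = ∀ k b → τ k ≡ just b → x k ≡ b

⊨-unrestricted : ∀ {m} (x : Fin m → Bool) → x ⊨ unrestricted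
⊨-unrestricted x k b ()

fill : ∀ {m} → Bool → Restriction m → Fin m → Bool
fill b τ k = fromMaybe b (τ k)

fill-⊨ : ∀ {m} b (τ : Restriction m) → fill b τ ⊨ τ
fill-⊨ b τ k c e rewrite e = refl

fix-free : ∀ {m} (τ : Restriction m) k b {k′} → fix τ k b k′ ≡ nothing → τ k′ ≡ nothing × k′ ≢ k
fix-free τ k b {k′} e with k′ Fin.≟ k
... | yes refl with () ← trans (sym (updateAt-updates k τ)) e
... | no k′≢k = trans (sym (updateAt-minimal k′ k τ k′≢k)) e , k′≢k

⊨-fix : ∀ {m} {x : Fin m → Bool} {τ k b} → x ⊨ τ → x k ≡ b → x ⊨ fix τ k b
⊨-fix {τ = τ} {k} x⊨τ xk≡b k′ b′ e with k′ Fin.≟ k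
... | yes refl = trans xk≡b (just-injective (trans (sym (updateAt-updates k τ)) e))
... | no k′≢k = x⊨τ k′ b′ (trans (sym (updateAt-minimal k′ k τ k′≢k)) e)

⊨-fix⁻ : ∀ {m} {x : Fin m → Bool} {τ k b} → τ k ≡ nothing → x ⊨ fix τ k b → x ⊨ τ × x k ≡ b
⊨-fix⁻ {x = x} {τ} {k} {b} τk≡∅ x⊨ = x⊨τ , x⊨ k b (updateAt-updates k τ)
  where
  x⊨τ : x ⊨ τ
  x⊨τ k′ b′ e with k′ Fin.≟ k
  ... | yes refl with () ← trans (sym τk≡∅) e
  ... | no k′≢k = x⊨ k′ b′ (trans (updateAt-minimal k′ k τ k′≢k) e)

⊨-free : ∀ {m} {x : Fin m → Bool} {τ k} b → τ k ≡ nothing → x ⊨ τ → x [ k ≔ b ] ⊨ τ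
⊨-free {x = x} {τ} {k} b τk≡∅ x⊨τ k′ b′ e with k′ Fin.≟ k
... | yes refl with () ← trans (sym τk≡∅) e
... | no k′≢k = trans (updateAt-minimal k′ k x k′≢k) (x⊨τ k′ b′ e)

≔-preserves : ∀ {m} {A : Set} {P : A → Set} {u : Fin m → A} {a} j →
  (∀ i → P (u i)) → P a → ∀ i → P ((u [ j ≔ a ]) i)
≔-preserves {P = P} {u} j Pu Pa i with i Fin.≟ j
... | yes refl = subst P (sym (updateAt-updates j u)) Pa
... | no i≢j   = subst P (sym (updateAt-minimal i j u i≢j)) (Pu i)

ComputesOn : ∀ {m} → DTree m → BoolFun m → Restriction m → Set
ComputesOn T h τ = ∀ x → x ⊨ τ → eval T x ≡ h x

ConstantOn : ∀ {m} → BoolFun m → Restriction m → Bool → Set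
ConstantOn h τ c = ∀ x → x ⊨ τ → h x ≡ c

RankAtLeast : ∀ {m} → BoolFun m → Restriction m → ℕ → Set
RankAtLeast h τ K = ∀ T → ComputesOn T h τ → K ≤ rank T

computesOn-unrestricted : ∀ {N} {h : BoolFun N} T → ComputesOn T h unrestricted → Computes T h
computesOn-unrestricted T T⊢ x = T⊢ x (⊨-unrestricted x)

module _ {m} {h : BoolFun m} where

  computesOn-fixed : ∀ {τ : Restriction m} {i T₀ T₁ b} → τ i ≡ just b →
    ComputesOn (node i T₀ T₁) h τ → ComputesOn (branch T₀ T₁ b) h τ
  computesOn-fixed {i = i} {T₀} {T₁} τi≡b T⊢ x x⊨τ =
    trans (sym (eval-node-at {t₀ = T₀} {T₁} (x⊨τ i _ τi≡b))) (T⊢ x x⊨τ)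

  computesOn-free : ∀ {τ : Restriction m} {i T₀ T₁} b → τ i ≡ nothing →
    ComputesOn (node i T₀ T₁) h τ → ComputesOn (branch T₀ T₁ b) h (fix τ i b)
  computesOn-free {i = i} {T₀} {T₁} b τi≡∅ T⊢ x x⊨ =
    trans (sym (eval-node-at {t₀ = T₀} {T₁} (proj₂ (⊨-fix⁻ τi≡∅ x⊨)))) (T⊢ x (proj₁ (⊨-fix⁻ τi≡∅ x⊨)))

  computesOn-node : ∀ {τ : Restriction m} {k T₀ T₁} → (∀ b → ComputesOn (branch T₀ T₁ b) h (fix τ k b)) →
    ComputesOn (node k T₀ T₁) h τ
  computesOn-node {k = k} {T₀} {T₁} T⊢ x x⊨τ = trans (eval-node k T₀ T₁ x) (T⊢ (x k) x (⊨-fix x⊨τ refl))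

  constantOn-fix⁻ : ∀ {τ : Restriction m} {k c} → (∀ b → ConstantOn h (fix τ k b) c) → ConstantOn h τ c
  constantOn-fix⁻ {k = k} h≡c x x⊨τ = h≡c (x k) x (⊨-fix x⊨τ refl)

  ¬rankAtLeast : ∀ {τ : Restriction m} {K} → ¬ RankAtLeast h τ (suc K) →
    DoubleNegation (Σ (DTree m) λ T → ComputesOn T h τ × rank T ≤ K)
  ¬rankAtLeast ¬R ¬T = ¬R λ T T⊢ → decidable-stable (_ ≤? _) λ T≱ → ¬T (T , T⊢ , ≮⇒≥ T≱)

  rankAtLeast-one⇒onto : ∀ {τ : Restriction m} → RankAtLeast h τ 1 → ∀ b →
    DoubleNegation (Σ (Fin m → Bool) λ x → x ⊨ τ × h x ≡ b)
  rankAtLeast-one⇒onto R b ¬x = 1+n≰n (R (leaf (not b)) λ x x⊨τ → sym (¬-not λ hx≡b → ¬x (x , x⊨τ , hx≡b)))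

  constant-or-rankAtLeast-one : ∀ {τ : Restriction m} →
    DoubleNegation (RankAtLeast h τ 1 ⊎ Σ Bool (ConstantOn h τ))
  constant-or-rankAtLeast-one ¬both = ¬both (inj₁ λ
    { (leaf c)       T⊢ → ⊥-elim (¬both (inj₂ (c , λ x x⊨τ → sym (T⊢ x x⊨τ))))
    ; (node i T₀ T₁) _  → rank-node-pos i T₀ T₁ })

  -- If neither half of τ keeps rank K+1, the two witnessing trees of rank ≤ K under a
  -- common root show that no tree on either half can have rank < K.
  rankAtLeast-split : ∀ {τ : Restriction m} {k K} → RankAtLeast h τ (suc K) →
    DoubleNegation (RankAtLeast h (fix τ k false) (suc K) ⊎ RankAtLeast h (fix τ k true) (suc K)
                    ⊎ (∀ b → RankAtLeast h (fix τ k b) K))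
  rankAtLeast-split {τ} {k} {K} R ¬split =
    ¬rankAtLeast (¬split ∘ inj₁) λ (T₀ , T₀⊢ , T₀≤K) →
    ¬rankAtLeast (¬split ∘ inj₂ ∘ inj₁) λ (T₁ , T₁⊢ , T₁≤K) →
    ¬split (inj₂ (inj₂ λ
      { false T T⊢ → decidable-stable (_ ≤? _) λ K≰T →
          too-small T T₁ (λ { false → T⊢ ; true → T₁⊢ }) (<⇒≤ (≰⇒> K≰T)) T₁≤K (inj₁ (≰⇒> K≰T))
      ; true T T⊢ → decidable-stable (_ ≤? _) λ K≰T →
          too-small T₀ T (λ { false → T₀⊢ ; true → T⊢ }) T₀≤K (<⇒≤ (≰⇒> K≰T)) (inj₂ (≰⇒> K≰T)) }))
    where
    too-small : ∀ T₀ T₁ → (∀ b → ComputesOn (branch T₀ T₁ b) h (fix τ k b)) →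
      rank T₀ ≤ K → rank T₁ ≤ K → rank T₀ < K ⊎ rank T₁ < K → ⊥
    too-small T₀ T₁ T⊢ T₀≤K T₁≤K one< =
      1+n≰n (≤-trans (R (node k T₀ T₁) (computesOn-node T⊢))
                     (subst (_≤ K) (sym (rank-node k T₀ T₁)) (joinRank-≤ T₀≤K T₁≤K one<)))

  rankAtLeast-one-split : ∀ {τ : Restriction m} {k} → RankAtLeast h τ 1 →
    DoubleNegation (RankAtLeast h (fix τ k false) 1 ⊎ RankAtLeast h (fix τ k true) 1
                    ⊎ Σ Bool λ b → ConstantOn h (fix τ k b) false × ConstantOn h (fix τ k (not b)) true)
  rankAtLeast-one-split {τ} {k} R ¬split =
    constant-or-rankAtLeast-one {τ = fix τ k false} λ
      { (inj₁ R₀) → ¬split (inj₁ R₀)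
      ; (inj₂ (c₀ , h₀)) → constant-or-rankAtLeast-one {τ = fix τ k true} λ
        { (inj₁ R₁) → ¬split (inj₂ (inj₁ R₁))
        ; (inj₂ (c₁ , h₁)) → both-constant c₀ c₁ h₀ h₁ } }
    where
    not-constant : ∀ c → (∀ b → ConstantOn h (fix τ k b) c) → ⊥
    not-constant c h≡c = 1+n≰n (R (leaf c) λ x x⊨τ → sym (constantOn-fix⁻ h≡c x x⊨τ))

    both-constant : ∀ c₀ c₁ → ConstantOn h (fix τ k false) c₀ → ConstantOn h (fix τ k true) c₁ → ⊥
    both-constant false false h₀ h₁ = not-constant false λ { false → h₀ ; true → h₁ }
    both-constant true  true  h₀ h₁ = not-constant true  λ { false → h₀ ; true → h₁ }
    both-constant false true  h₀ h₁ = ¬split (inj₂ (inj₂ (false , h₀ , h₁)))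
    both-constant true  false h₀ h₁ = ¬split (inj₂ (inj₂ (true , h₁ , h₀)))

-- Weighted depth of read-once trees

data ReadOnce {n : ℕ} : Restriction n → DTree n → Set where
  leaf : ∀ {σ b} → ReadOnce σ (leaf b)
  node : ∀ {σ j S₀ S₁} → σ j ≡ nothing →
         ReadOnce (fix σ j false) S₀ → ReadOnce (fix σ j true) S₁ → ReadOnce σ (node j S₀ S₁)

cost : ∀ {n} → (Fin n → ℕ) → DTree n → ℕ
cost w (leaf _)       = 0
cost w (node j S₀ S₁) = w j + (cost w S₀ ⊔ cost w S₁)

-- The extra unit is paid for by the node of rank ≥ 1 at which the adversary commits a block.
cost⁺ : ∀ {n} → (Fin n → ℕ) → DTree n → ℕ
cost⁺ w (leaf _)       = 0
cost⁺ w S@(node _ _ _) = suc (cost w S)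

cost-const : ∀ {n} c (S : DTree n) → cost (const c) S ≡ depth S * c
cost-const c (leaf _)       = refl
cost-const c (node j S₀ S₁) rewrite cost-const c S₀ | cost-const c S₁ =
  cong (c +_) (sym (*-distribʳ-⊔ c (depth S₀) (depth S₁)))

cost-mono : ∀ {n} {σ : Restriction n} {S} {w w′ : Fin n → ℕ} → ReadOnce σ S →
  (∀ j → σ j ≡ nothing → w j ≤ w′ j) → cost w S ≤ cost w′ S
cost-mono leaf w≤w′ = z≤n
cost-mono {σ = σ} (node {j = j} σj≡∅ S₀ S₁) w≤w′ =
  +-mono-≤ (w≤w′ j σj≡∅) (⊔-mono-≤ (cost-mono S₀ (λ i e → w≤w′ i (proj₁ (fix-free σ j false e))))
                                  (cost-mono S₁ (λ i e → w≤w′ i (proj₁ (fix-free σ j true e)))))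

-- A read-once tree meets the variable j at most once on every path.
cost-≤-suc : ∀ {n} {σ : Restriction n} {S} {w w′ : Fin n → ℕ} {j} → ReadOnce σ S →
  (∀ j′ → σ j′ ≡ nothing → j′ ≢ j → w j′ ≤ w′ j′) → w j ≤ suc (w′ j) → cost w S ≤ suc (cost w′ S)
cost-≤-suc leaf _ _ = z≤n
cost-≤-suc {σ = σ} {w = w} {w′} {j} (node {j = j′} {S₀} {S₁} σj′≡∅ R₀ R₁) w≤w′ wj≤ with j′ Fin.≟ j
... | yes refl =
  +-mono-≤ wj≤ (⊔-mono-≤ (cost-mono R₀ (λ i e → uncurry (w≤w′ i) (fix-free σ j false e)))
                         (cost-mono R₁ (λ i e → uncurry (w≤w′ i) (fix-free σ j true e))))
... | no j′≢j =
  ≤-trans (+-mono-≤ (w≤w′ j′ σj′≡∅ j′≢j)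
                    (⊔-mono-≤ (cost-≤-suc R₀ (λ i e → w≤w′ i (proj₁ (fix-free σ j′ false e))) wj≤)
                              (cost-≤-suc R₁ (λ i e → w≤w′ i (proj₁ (fix-free σ j′ true e))) wj≤)))
          (≤-reflexive (+-suc (w′ j′) (cost w′ S₀ ⊔ cost w′ S₁)))

cost⁺-decrement : ∀ {n} {σ : Restriction n} {S} {w : Fin n → ℕ} {j v} → ReadOnce σ S →
  w j ≡ suc v → cost⁺ w S ≤ suc (cost⁺ (w [ j ≔ v ]) S)
cost⁺-decrement leaf _ = z≤n
cost⁺-decrement {w = w} {j} {v} R@(node _ _ _) wj≡1+v =
  s≤s (cost-≤-suc R (λ j′ _ j′≢j → ≤-reflexive (sym (updateAt-minimal j′ j w j′≢j)))
                    (≤-reflexive (trans wj≡1+v (cong suc (sym (updateAt-updates j w))))))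

cost⁺-node≤ : ∀ {n} {w : Fin n → ℕ} {j S₀ S₁ K} → w j ≡ 0 →
  cost⁺ w S₀ ≤ K → cost⁺ w S₁ ≤ K → 1 ≤ K → cost⁺ w (node j S₀ S₁) ≤ K
cost⁺-node≤ {w = w} {S₀ = S₀} {S₁} {K} wj≡0 S₀≤K S₁≤K 1≤K
  rewrite wj≡0 = ⊔-lub (suc-cost≤ S₀ S₀≤K) (suc-cost≤ S₁ S₁≤K)
  where
  suc-cost≤ : ∀ S → cost⁺ w S ≤ K → suc (cost w S) ≤ K
  suc-cost≤ (leaf _)       _ = 1≤K
  suc-cost≤ (node _ _ _) S≤K = S≤K

module Blocks {n m : ℕ} where

  BlockRestriction : Set
  BlockRestriction = Fin n → Restriction m

  block : (Fin (n * m) → Bool) → Fin n → Fin m → Bool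
  block x j k = x (combine j k)

  unblock : (Fin n → Fin m → Bool) → Fin (n * m) → Bool
  unblock Z i = uncurry Z (remQuot m i)

  block-unblock : ∀ Z j k → block (unblock Z) j k ≡ Z j k
  block-unblock Z j k = cong (uncurry Z) (remQuot-combine j k)

  infix 4 _⊨ᴮ_

  _⊨ᴮ_ : (Fin (n * m) → Bool) → BlockRestriction → Set
  x ⊨ᴮ ρ = ∀ j → block x j ⊨ ρ j

  unblock-⊨ᴮ : ∀ {Z ρ} → (∀ j → Z j ⊨ ρ j) → unblock Z ⊨ᴮ ρ
  unblock-⊨ᴮ {Z} Z⊨ρ j k b e = trans (block-unblock Z j k) (Z⊨ρ j k b e)

  fixᴮ : BlockRestriction → Fin n → Fin m → Bool → BlockRestriction
  fixᴮ ρ j k b = ρ [ j ≔ fix (ρ j) k b ]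

  ⊨ᴮ-fix⁻ : ∀ {x ρ j k b} → ρ j k ≡ nothing → x ⊨ᴮ fixᴮ ρ j k b → x ⊨ᴮ ρ × x (combine j k) ≡ b
  ⊨ᴮ-fix⁻ {x} {ρ} {j} {k} {b} ρjk≡∅ x⊨ = x⊨ρ , proj₂ (⊨-fix⁻ ρjk≡∅ x⊨j)
    where
    x⊨j : block x j ⊨ fix (ρ j) k b
    x⊨j = subst (block x j ⊨_) (updateAt-updates j ρ) (x⊨ j)
    x⊨ρ : x ⊨ᴮ ρ
    x⊨ρ j′ with j′ Fin.≟ j
    ... | yes refl = proj₁ (⊨-fix⁻ ρjk≡∅ x⊨j)
    ... | no j′≢j = subst (block x j′ ⊨_) (updateAt-minimal j′ j ρ j′≢j) (x⊨ j′)

  ComputesOnᴮ : DTree (n * m) → BoolFun (n * m) → BlockRestriction → Set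
  ComputesOnᴮ T F ρ = ∀ x → x ⊨ᴮ ρ → eval T x ≡ F x

  module _ {F : BoolFun (n * m)} {ρ : BlockRestriction} {j : Fin n} {k : Fin m} {T₀ T₁ : DTree (n * m)} where

    computesOnᴮ-fixed : ∀ {b} → ρ j k ≡ just b →
      ComputesOnᴮ (node (combine j k) T₀ T₁) F ρ → ComputesOnᴮ (branch T₀ T₁ b) F ρ
    computesOnᴮ-fixed ρjk≡b T⊢ x x⊨ρ =
      trans (sym (eval-node-at {t₀ = T₀} {T₁} (x⊨ρ j k _ ρjk≡b))) (T⊢ x x⊨ρ)

    computesOnᴮ-free : ∀ b → ρ j k ≡ nothing →
      ComputesOnᴮ (node (combine j k) T₀ T₁) F ρ → ComputesOnᴮ (branch T₀ T₁ b) F (fixᴮ ρ j k b)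
    computesOnᴮ-free b ρjk≡∅ T⊢ x x⊨ =
      trans (sym (eval-node-at {t₀ = T₀} {T₁} (proj₂ x⊨ρ×xi≡b))) (T⊢ x (proj₁ x⊨ρ×xi≡b))
      where x⊨ρ×xi≡b = ⊨ᴮ-fix⁻ {x} {ρ} {j} {k} {b} ρjk≡∅ x⊨

  data BlockIndex : Fin (n * m) → Set where
    at : (j : Fin n) (k : Fin m) → BlockIndex (combine j k)

  blockIndex : ∀ i → BlockIndex i
  blockIndex i = subst BlockIndex (combine-remQuot {n} m i) (at _ _)

-- The lower bound

module CompositionLowerBound {n m : ℕ} (f : BoolFun n) (g : BoolFun m)
  (f-cong : ∀ {y y′} → (∀ j → y j ≡ y′ j) → f y ≡ f y′)
  (g-cong : ∀ {z z′} → (∀ k → z k ≡ z′ k) → g z ≡ g z′) where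

  open Blocks {n} {m}

  -- σ j = just c records that the adversary has committed block j to the g-value c;
  -- an uncommitted block of budget w still needs rank w + 1 to compute g.
  BlockState : Restriction m → Maybe Bool → ℕ → Set
  BlockState τ (just c) _ = ConstantOn g τ c
  BlockState τ nothing  w = RankAtLeast g τ (suc w)

  Invariant : BlockRestriction → Restriction n → (Fin n → ℕ) → Set
  Invariant ρ σ w = ∀ j → BlockState (ρ j) (σ j) (w j)

  invariant-update : ∀ {ρ σ w σ′ w′} → Invariant ρ σ w → ∀ j τ → BlockState τ (σ′ j) (w′ j) →
    (∀ j′ → j′ ≢ j → σ′ j′ ≡ σ j′) → (∀ j′ → j′ ≢ j → w′ j′ ≡ w j′) → Invariant (ρ [ j ≔ τ ]) σ′ w′
  invariant-update {ρ} {σ′ = σ′} {w′} inv j τ st σ′≈σ w′≈w j′ with j′ Fin.≟ j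
  ... | yes refl = subst (λ τ′ → BlockState τ′ (σ′ j) (w′ j)) (sym (updateAt-updates j ρ)) st
  ... | no j′≢j =
    subst (λ τ′ → BlockState τ′ (σ′ j′) (w′ j′)) (sym (updateAt-minimal j′ j ρ j′≢j))
          (subst₂ (BlockState (ρ j′)) (sym (σ′≈σ j′ j′≢j)) (sym (w′≈w j′ j′≢j)) (inv j′))

  Extracted : Restriction n → (Fin n → ℕ) → DTree (n * m) → Set
  Extracted σ w T = Σ (DTree n) λ S → ReadOnce σ S × ComputesOn S f σ × cost⁺ w S ≤ rank T

  -- The adversary asks whether subfunctions of g keep a given rank, which is not decidable
  -- here; the simulation therefore runs in the double-negation monad, and the final
  -- inequality, being decidable, is recovered by stability.
  Simulates : DTree (n * m) → Set
  Simulates T = ∀ ρ σ w → Invariant ρ σ w → ComputesOnᴮ T (compose f g) ρ → DoubleNegation (Extracted σ w T)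

  realizable : ∀ {τ s v} → BlockState τ s v →
    DoubleNegation (∀ b → (∀ c → s ≡ just c → b ≡ c) → Σ (Fin m → Bool) λ z → z ⊨ τ × g z ≡ b)
  realizable {τ} {just c} g≡c = pure λ b b≡c →
    fill false τ , fill-⊨ false τ , trans (g≡c _ (fill-⊨ false τ)) (sym (b≡c c refl))
  realizable {τ} {nothing} R =
    onto false >>= λ z₀ → onto true >>= λ z₁ → pure λ { false _ → z₀ ; true _ → z₁ }
    where onto = rankAtLeast-one⇒onto (λ T T⊢ → ≤-trans (s≤s z≤n) (R T T⊢))

  simulates-leaf : ∀ c → Simulates (leaf c)
  simulates-leaf c ρ σ w inv T⊢ =
    ¬¬-Π-Fin (λ j → realizable (inv j)) >>= λ realized →
    pure (leaf c , leaf , (λ y y⊨σ → f-at y (λ j → realized j (y j) (y⊨σ j))) , z≤n)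
    where
    f-at : ∀ y → (∀ j → Σ (Fin m → Bool) λ z → z ⊨ ρ j × g z ≡ y j) → c ≡ f y
    f-at y Z = trans (T⊢ x (unblock-⊨ᴮ (proj₁ ∘ proj₂ ∘ Z)))
                     (f-cong λ j → trans (g-cong (block-unblock (proj₁ ∘ Z) j)) (proj₂ (proj₂ (Z j))))
      where x = unblock (proj₁ ∘ Z)

  module Step (j : Fin n) (k : Fin m) (T₀ T₁ : DTree (n * m)) (sim : ∀ b → Simulates (branch T₀ T₁ b))
    {ρ σ w} (inv : Invariant ρ σ w) (T⊢ : ComputesOnᴮ (node (combine j k) T₀ T₁) (compose f g) ρ) where

    T : DTree (n * m)
    T = node (combine j k) T₀ T₁

    lift : ∀ {σ′ w′} b → DoubleNegation (Extracted σ′ w′ (branch T₀ T₁ b)) → DoubleNegation (Extracted σ′ w′ T)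
    lift b ex = ex >>= λ (S , S-once , S⊢ , S≤) →
      pure (S , S-once , S⊢ , ≤-trans S≤ (rank-branch≤rank-node (combine j k) T₀ T₁ b))

    descend : ∀ b {σ′ w′} → ρ j k ≡ nothing → BlockState (fix (ρ j) k b) (σ′ j) (w′ j) →
      (∀ j′ → j′ ≢ j → σ′ j′ ≡ σ j′) → (∀ j′ → j′ ≢ j → w′ j′ ≡ w j′) →
      DoubleNegation (Extracted σ′ w′ (branch T₀ T₁ b))
    descend b ρjk≡∅ st σ′≈σ w′≈w =
      sim b (fixᴮ ρ j k b) _ _ (invariant-update inv j _ st σ′≈σ w′≈w) (computesOnᴮ-free b ρjk≡∅ T⊢)

    state : ∀ {s} → σ j ≡ s → BlockState (ρ j) s (w j)
    state σj≡s = subst (λ s → BlockState (ρ j) s (w j)) σj≡s (inv j)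

    keep : ∀ {s} b → ρ j k ≡ nothing → σ j ≡ s → BlockState (fix (ρ j) k b) s (w j) →
      DoubleNegation (Extracted σ w T)
    keep b ρjk≡∅ σj≡s st =
      lift b (descend b ρjk≡∅ (subst (λ s → BlockState _ s (w j)) (sym σj≡s) st) (λ _ _ → refl) (λ _ _ → refl))

    committed : ∀ {c} → ρ j k ≡ nothing → σ j ≡ just c → DoubleNegation (Extracted σ w T)
    committed ρjk≡∅ σj≡c = keep false ρjk≡∅ σj≡c λ z z⊨ → state σj≡c z (proj₁ (⊨-fix⁻ ρjk≡∅ z⊨))

    -- Follow the lighter branch: the rank drops by one, and so does the budget of block j.
    spend : ∀ {v} → ρ j k ≡ nothing → σ j ≡ nothing → w j ≡ suc v →
      (∀ b → RankAtLeast g (fix (ρ j) k b) (suc v)) → DoubleNegation (Extracted σ w T)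
    spend {v} ρjk≡∅ σj≡∅ wj≡1+v R with lighter-branch (combine j k) T₀ T₁
    ... | b , lighter =
      descend b ρjk≡∅ st (λ _ _ → refl) (λ j′ j′≢j → updateAt-minimal j′ j w j′≢j)
        >>= λ (S , S-once , S⊢ , S≤) →
      pure (S , S-once , S⊢ , ≤-trans (cost⁺-decrement S-once wj≡1+v) (≤-trans (s≤s S≤) lighter))
      where
      st : BlockState (fix (ρ j) k b) (σ j) ((w [ j ≔ v ]) j)
      st = subst₂ (BlockState (fix (ρ j) k b)) (sym σj≡∅) (sym (updateAt-updates j w)) (R b)

    -- With no budget left, the adversary commits block j to the value of g on each half
    -- and the extracted tree queries the variable j of f.
    commit : ∀ b → ρ j k ≡ nothing → σ j ≡ nothing → w j ≡ 0 →
      ConstantOn g (fix (ρ j) k b) false → ConstantOn g (fix (ρ j) k (not b)) true →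
      DoubleNegation (Extracted σ w T)
    commit b ρjk≡∅ σj≡∅ wj≡0 g≡0 g≡1 =
      descend b ρjk≡∅ (committed-to false g≡0) σ′≈σ (λ _ _ → refl) >>= λ (S₀ , S₀-once , S₀⊢ , S₀≤) →
      descend (not b) ρjk≡∅ (committed-to true g≡1) σ′≈σ (λ _ _ → refl) >>= λ (S₁ , S₁-once , S₁⊢ , S₁≤) →
      pure (node j S₀ S₁ , node σj≡∅ S₀-once S₁-once , computesOn-node (λ { false → S₀⊢ ; true → S₁⊢ }) ,
            cost⁺-node≤ wj≡0 (≤-trans S₀≤ (rank-branch≤rank-node (combine j k) T₀ T₁ b))
                             (≤-trans S₁≤ (rank-branch≤rank-node (combine j k) T₀ T₁ (not b)))
                             (rank-node-pos (combine j k) T₀ T₁))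
      where
      committed-to : ∀ c {τ} → ConstantOn g τ c → BlockState τ (fix σ j c j) (w j)
      committed-to c g≡c = subst (λ s → BlockState _ s (w j)) (sym (updateAt-updates j σ)) g≡c
      σ′≈σ : ∀ {c} j′ → j′ ≢ j → fix σ j c j′ ≡ σ j′
      σ′≈σ j′ j′≢j = updateAt-minimal j′ j σ j′≢j

    uncommitted : ρ j k ≡ nothing → σ j ≡ nothing → DoubleNegation (Extracted σ w T)
    uncommitted ρjk≡∅ σj≡∅ = by-budget (w j) refl (state σj≡∅) (λ b → keep b ρjk≡∅ σj≡∅)
      where
      by-budget : ∀ v → w j ≡ v → RankAtLeast g (ρ j) (suc v) →
        (∀ b → RankAtLeast g (fix (ρ j) k b) (suc v) → DoubleNegation (Extracted σ w T)) →
        DoubleNegation (Extracted σ w T)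
      by-budget zero    wj≡0   R keep-half = rankAtLeast-one-split R >>= λ
        { (inj₁ R₀)                     → keep-half false R₀
        ; (inj₂ (inj₁ R₁))              → keep-half true R₁
        ; (inj₂ (inj₂ (b , g≡0 , g≡1))) → commit b ρjk≡∅ σj≡∅ wj≡0 g≡0 g≡1 }
      by-budget (suc v) wj≡1+v R keep-half = rankAtLeast-split R >>= λ
        { (inj₁ R₀)         → keep-half false R₀
        ; (inj₂ (inj₁ R₁))  → keep-half true R₁
        ; (inj₂ (inj₂ R₀₁)) → spend ρjk≡∅ σj≡∅ wj≡1+v R₀₁ }

    extract : DoubleNegation (Extracted σ w T)
    extract with ρ j k in ρjk | σ j in σj
    ... | just b  | _       = lift b (sim b ρ σ w inv (computesOnᴮ-fixed ρjk T⊢))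
    ... | nothing | just c  = committed ρjk σj
    ... | nothing | nothing = uncommitted ρjk σj

  simulates : ∀ T → Simulates T
  simulates (leaf c) = simulates-leaf c
  simulates (node i T₀ T₁) with blockIndex i
  ... | at j k = λ ρ σ w inv T⊢ →
    Step.extract j k T₀ T₁ (λ { false → simulates T₀ ; true → simulates T₁ }) inv T⊢

rank-compose≥ : ∀ {n m} {f : BoolFun n} {g : BoolFun m} {d r R} → NonConstant f → NonConstant g →
  IsDepth f d → IsRank g r → IsRank (compose f g) R → d * (r ∸ 1) + 1 ≤ R
rank-compose≥ {r = zero} _ g≠ _ ((G , G⊢ , G≡0) , _) _ =
  ⊥-elim (1+n≰n (subst (1 ≤_) G≡0 (nonConstant⇒rank-pos g≠ G G⊢)))
rank-compose≥ {f = f} {g} {d} {suc r} f≠ _ ((S₀ , S₀⊢ , _) , d-min) ((G , G⊢ , _) , r-min)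
              ((T , T⊢ , refl) , _) =
  decidable-stable (_ ≤? _)
    (simulates T (λ _ → unrestricted) unrestricted (const r)
               (λ _ G′ G′⊢ → r-min G′ (computesOn-unrestricted G′ G′⊢)) (λ x _ → T⊢ x)
     >>= λ (S , _ , S⊢ , S≤) → pure (bound S (computesOn-unrestricted S S⊢) S≤))
  where
  open CompositionLowerBound f g (computes⇒cong S₀ S₀⊢) (computes⇒cong G G⊢)
  bound : ∀ S → Computes S f → cost⁺ (const r) S ≤ rank T → d * r + 1 ≤ rank T
  bound (leaf c)       S⊢ _  = ⊥-elim (nonConstant-¬leaf f≠ S⊢)
  bound S@(node _ _ _) S⊢ S≤ = begin
    d * r + 1              ≡⟨ +-comm (d * r) 1 ⟩
    suc (d * r)            ≤⟨ s≤s (*-monoˡ-≤ r (d-min S S⊢)) ⟩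
    suc (depth S * r)      ≡⟨ cong suc (sym (cost-const r S)) ⟩
    cost⁺ (const r) S      ≤⟨ S≤ ⟩
    rank T                 ∎
    where open ≤-Reasoning

AND-true : ∀ n (x : Fin n → Bool) → (∀ i → x i ≡ true) → AND n x ≡ true
AND-true zero    x x≡1 = refl
AND-true (suc n) x x≡1 rewrite x≡1 fzero = AND-true n (x ∘ fsuc) (x≡1 ∘ fsuc)

AND-false : ∀ n (x : Fin n → Bool) i → x i ≡ false → AND n x ≡ false
AND-false (suc n) x fzero    xi≡0 rewrite xi≡0 = refl
AND-false (suc n) x (fsuc i) xi≡0 with x fzero
... | true  = AND-false n (x ∘ fsuc) i xi≡0
... | false = refl

OR-false : ∀ n (x : Fin n → Bool) → (∀ i → x i ≡ false) → OR n x ≡ false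
OR-false zero    x x≡0 = refl
OR-false (suc n) x x≡0 rewrite x≡0 fzero = OR-false n (x ∘ fsuc) (x≡0 ∘ fsuc)

OR-true : ∀ n (x : Fin n → Bool) i → x i ≡ true → OR n x ≡ true
OR-true (suc n) x fzero    xi≡1 rewrite xi≡1 = refl
OR-true (suc n) x (fsuc i) xi≡1 with x fzero
... | false = OR-true n (x ∘ fsuc) i xi≡1
... | true  = refl

OR-not : ∀ n (x : Fin n → Bool) → OR n (not ∘ x) ≡ not (AND n x)
OR-not zero    x = refl
OR-not (suc n) x with x fzero
... | true  = OR-not n (x ∘ fsuc)
... | false = refl

AND-not : ∀ n (x : Fin n → Bool) → AND n (not ∘ x) ≡ not (OR n x)
AND-not zero    x = refl
AND-not (suc n) x with x fzero
... | false = AND-not n (x ∘ fsuc)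
... | true  = refl

PARITY-flip : ∀ m (x : Fin m → Bool) k → PARITY m (x [ k ≔ not (x k) ]) ≡ not (PARITY m x)
PARITY-flip (suc m) x fzero    = sym (not-distribˡ-xor (x fzero) _)
PARITY-flip (suc m) x (fsuc k) =
  trans (cong (x fzero xor_) (PARITY-flip m (x ∘ fsuc) k)) (sym (not-distribʳ-xor (x fzero) _))

AND-nonConstant : ∀ n → NonConstant (AND (suc n))
AND-nonConstant n = const true , const false , not-¬ (AND-true n _ λ _ → refl)

OR-nonConstant : ∀ n → NonConstant (OR (suc n))
OR-nonConstant n = const false , const true , not-¬ (OR-false n _ λ _ → refl)

PARITY-nonConstant : ∀ m → NonConstant (PARITY (suc m))
PARITY-nonConstant m = x , x [ fzero ≔ true ] , λ e → not-¬ refl (trans e (PARITY-flip (suc m) x fzero))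
  where x = const false

andTree : ∀ {N} n → (Fin n → Fin N) → DTree N
andTree zero    φ = leaf true
andTree (suc n) φ = node (φ fzero) (leaf false) (andTree n (φ ∘ fsuc))

orTree : ∀ {N} n → (Fin n → Fin N) → DTree N
orTree zero    φ = leaf false
orTree (suc n) φ = node (φ fzero) (orTree n (φ ∘ fsuc)) (leaf true)

eval-andTree : ∀ {N} n (φ : Fin n → Fin N) x → eval (andTree n φ) x ≡ AND n (x ∘ φ)
eval-andTree zero    φ x = refl
eval-andTree (suc n) φ x with x (φ fzero)
... | true  = eval-andTree n (φ ∘ fsuc) x
... | false = refl

eval-orTree : ∀ {N} n (φ : Fin n → Fin N) x → eval (orTree n φ) x ≡ OR n (x ∘ φ)
eval-orTree zero    φ x = refl
eval-orTree (suc n) φ x with x (φ fzero)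
... | false = eval-orTree n (φ ∘ fsuc) x
... | true  = refl

AND-cong : ∀ n {x y : Fin n → Bool} → (∀ i → x i ≡ y i) → AND n x ≡ AND n y
AND-cong n = computes⇒cong (andTree n id) (eval-andTree n id)

depth-andTree : ∀ {N} n (φ : Fin n → Fin N) → depth (andTree n φ) ≡ n
depth-andTree zero    φ = refl
depth-andTree (suc n) φ = cong suc (depth-andTree n (φ ∘ fsuc))

depth-orTree : ∀ {N} n (φ : Fin n → Fin N) → depth (orTree n φ) ≡ n
depth-orTree zero    φ = refl
depth-orTree (suc n) φ = cong suc (trans (⊔-identityʳ _) (depth-orTree n (φ ∘ fsuc)))

rank-andTree : ∀ {N} n (φ : Fin n → Fin N) → rank (andTree n φ) ≤ 1
rank-andTree zero    φ = z≤n
rank-andTree (suc n) φ rewrite rank-node (φ fzero) (leaf false) (andTree n (φ ∘ fsuc)) =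
  joinRank-≤ z≤n (rank-andTree n (φ ∘ fsuc)) (inj₁ (s≤s z≤n))

rank-orTree : ∀ {N} n (φ : Fin n → Fin N) → rank (orTree n φ) ≤ 1
rank-orTree zero    φ = z≤n
rank-orTree (suc n) φ rewrite rank-node (φ fzero) (orTree n (φ ∘ fsuc)) (leaf true) =
  joinRank-≤ (rank-orTree n (φ ∘ fsuc)) z≤n (inj₂ (s≤s z≤n))

parityTree : ∀ {N} m → (Fin m → Fin N) → (Bool → DTree N) → DTree N
parityTree zero    φ h = h false
parityTree (suc m) φ h = node (φ fzero) (parityTree m (φ ∘ fsuc) h) (parityTree m (φ ∘ fsuc) (h ∘ not))

eval-parityTree : ∀ {N} m (φ : Fin m → Fin N) h x → eval (parityTree m φ h) x ≡ eval (h (PARITY m (x ∘ φ))) x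
eval-parityTree zero    φ h x = refl
eval-parityTree (suc m) φ h x with x (φ fzero)
... | false = eval-parityTree m (φ ∘ fsuc) h x
... | true  = eval-parityTree m (φ ∘ fsuc) (h ∘ not) x

rank-parityTree : ∀ {N} m (φ : Fin (suc m) → Fin N) h →
  rank (parityTree (suc m) φ h) ≤ m + joinRank (rank (h false)) (rank (h true))
rank-parityTree zero    φ h = ≤-reflexive (rank-node (φ fzero) (h false) (h true))
rank-parityTree (suc m) φ h = begin
  rank (node (φ fzero) A B)   ≡⟨ rank-node (φ fzero) A B ⟩
  joinRank (rank A) (rank B)  ≤⟨ joinRank-≤-suc (rank A) (rank B) ⟩
  suc (rank A ⊔ rank B)       ≤⟨ s≤s (⊔-lub (rank-parityTree m (φ ∘ fsuc) h) B≤) ⟩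
  suc (m + K)                 ∎
  where
  open ≤-Reasoning
  A = parityTree (suc m) (φ ∘ fsuc) h
  B = parityTree (suc m) (φ ∘ fsuc) (h ∘ not)
  K = joinRank (rank (h false)) (rank (h true))
  B≤ : rank B ≤ m + K
  B≤ = subst (λ r → rank B ≤ m + r) (joinRank-comm (rank (h true)) (rank (h false)))
             (rank-parityTree m (φ ∘ fsuc) (h ∘ not))

rank-PARITY≤ : ∀ m → rank (parityTree m id leaf) ≤ m
rank-PARITY≤ zero    = z≤n
rank-PARITY≤ (suc m) = ≤-trans (rank-parityTree m id leaf) (≤-reflexive (+-comm m 1))

andParityTree : ∀ {N} n m → (Fin n → Fin m → Fin N) → DTree N
andParityTree zero    m β = leaf true
andParityTree (suc n) m β = parityTree m (β fzero) (branch (leaf false) (andParityTree n m (β ∘ fsuc)))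

eval-andParityTree : ∀ {N} n m (β : Fin n → Fin m → Fin N) x →
  eval (andParityTree n m β) x ≡ AND n (λ i → PARITY m (λ k → x (β i k)))
eval-andParityTree zero    m β x = refl
eval-andParityTree (suc n) m β x
  rewrite eval-parityTree m (β fzero) (branch (leaf false) (andParityTree n m (β ∘ fsuc))) x
  with PARITY m (x ∘ β fzero)
... | false = refl
... | true  = eval-andParityTree n m (β ∘ fsuc) x

rank-andParityTree : ∀ {N} n m (β : Fin n → Fin (suc m) → Fin N) → rank (andParityTree n (suc m) β) ≤ n * m + 1
rank-andParityTree zero    m β = z≤n
rank-andParityTree (suc n) m β =
  ≤-trans (rank-parityTree m (β fzero) (branch (leaf false) (andParityTree n (suc m) (β ∘ fsuc))))
          (≤-trans (+-monoʳ-≤ m (⊔-lub (rank-andParityTree n m (β ∘ fsuc)) (m≤n+m 1 (n * m))))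
                   (≤-reflexive (sym (+-assoc m (n * m) 1))))

isFree : Maybe Bool → ℕ
isFree nothing  = 1
isFree (just _) = 0

freeCount : ∀ {m} → Restriction m → ℕ
freeCount {zero}  τ = 0
freeCount {suc m} τ = isFree (τ fzero) + freeCount (τ ∘ fsuc)

freeCount-unrestricted : ∀ m → freeCount (unrestricted {m}) ≡ m
freeCount-unrestricted zero    = refl
freeCount-unrestricted (suc m) = cong suc (freeCount-unrestricted m)

freeCount-fix : ∀ {m} (τ : Restriction m) k b → τ k ≡ nothing → freeCount τ ≡ suc (freeCount (fix τ k b))
freeCount-fix {suc m} τ fzero    b τk≡∅ rewrite τk≡∅ = refl
freeCount-fix {suc m} τ (fsuc k) b τk≡∅ =
  trans (cong (isFree (τ fzero) +_) (freeCount-fix (τ ∘ fsuc) k b τk≡∅)) (+-suc (isFree (τ fzero)) _)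

freeCount-zero-or-free : ∀ {m} (τ : Restriction m) → freeCount τ ≡ 0 ⊎ Σ (Fin m) λ k → τ k ≡ nothing
freeCount-zero-or-free {zero}  τ = inj₁ refl
freeCount-zero-or-free {suc m} τ with τ fzero in τ0 | freeCount-zero-or-free (τ ∘ fsuc)
... | nothing | _              = inj₂ (fzero , τ0)
... | just _  | inj₁ none      = inj₁ none
... | just _  | inj₂ (k , τk≡∅) = inj₂ (fsuc k , τk≡∅)

leaf-constant : ∀ {m} {h : BoolFun m} {τ c x y} → ComputesOn (leaf c) h τ → x ⊨ τ → y ⊨ τ → h x ≡ h y
leaf-constant {x = x} {y} leaf⊢ x⊨τ y⊨τ = trans (sym (leaf⊢ x x⊨τ)) (leaf⊢ y y⊨τ)

depth-branch<depth-node : ∀ {N} (i : Fin N) t₀ t₁ b → depth (branch t₀ t₁ b) < depth (node i t₀ t₁)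
depth-branch<depth-node i t₀ t₁ false = s≤s (m≤m⊔n (depth t₀) (depth t₁))
depth-branch<depth-node i t₀ t₁ true  = s≤s (m≤n⊔m (depth t₀) (depth t₁))

-- As for AND at v = true: since h flips as soon as any coordinate leaves v, every
-- variable is queried on the path of const v.
module SensitiveAt {m} {h : BoolFun m} {v c : Bool}
  (h-at-v : h (const v) ≡ c) (h-off-v : ∀ x i → x i ≡ not v → h x ≡ not c) where

  freeCount≤depth : ∀ T τ → const v ⊨ τ → ComputesOn T h τ → freeCount τ ≤ depth T
  freeCount≤depth (leaf c′) τ v⊨τ T⊢ with freeCount-zero-or-free τ
  ... | inj₁ none = ≤-reflexive none
  ... | inj₂ (k , τk≡∅) =
    ⊥-elim (not-¬ refl (trans (sym h-at-v) (trans (leaf-constant T⊢ v⊨τ (⊨-free (not v) τk≡∅ v⊨τ))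
                                                   (h-off-v _ k (updateAt-updates k (const v))))))
  freeCount≤depth (node i T₀ T₁) τ v⊨τ T⊢ = by-query (τ i) refl
    where
    open ≤-Reasoning
    on-branch : ∀ b {τ} → const v ⊨ τ → ComputesOn (branch T₀ T₁ b) h τ → freeCount τ ≤ depth (branch T₀ T₁ b)
    on-branch false = freeCount≤depth T₀ _
    on-branch true  = freeCount≤depth T₁ _
    by-query : ∀ s → τ i ≡ s → freeCount τ ≤ depth (node i T₀ T₁)
    by-query (just b) τi = <⇒≤ (≤-trans (s≤s (on-branch b v⊨τ (computesOn-fixed τi T⊢)))
                                        (depth-branch<depth-node i T₀ T₁ b))
    by-query nothing  τi = begin
      freeCount τ                   ≡⟨ freeCount-fix τ i v τi ⟩
      suc (freeCount (fix τ i v))   ≤⟨ s≤s (on-branch v (⊨-fix v⊨τ refl) (computesOn-free v τi T⊢)) ⟩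
      suc (depth (branch T₀ T₁ v))  ≤⟨ depth-branch<depth-node i T₀ T₁ v ⟩
      depth (node i T₀ T₁)          ∎

  arity≤depth : ∀ T → Computes T h → m ≤ depth T
  arity≤depth T T⊢ = subst (_≤ depth T) (freeCount-unrestricted m)
    (freeCount≤depth T unrestricted (⊨-unrestricted (const v)) (λ x _ → T⊢ x))

-- PARITY flips with every variable, so each free variable costs one unit of rank.
freeCount≤rank-PARITY : ∀ {m} T (τ : Restriction m) → ComputesOn T (PARITY m) τ → freeCount τ ≤ rank T
freeCount≤rank-PARITY {m} (leaf c) τ T⊢ with freeCount-zero-or-free τ
... | inj₁ none = ≤-reflexive none
... | inj₂ (k , τk≡∅) =
  ⊥-elim (not-¬ refl (trans (leaf-constant T⊢ (fill-⊨ false τ) (⊨-free (not (x k)) τk≡∅ (fill-⊨ false τ)))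
                            (PARITY-flip m x k)))
  where x = fill false τ
freeCount≤rank-PARITY (node i T₀ T₁) τ T⊢ = by-query (τ i) refl
  where
  open ≤-Reasoning
  on-branch : ∀ b {τ} → ComputesOn (branch T₀ T₁ b) _ τ → freeCount τ ≤ rank (branch T₀ T₁ b)
  on-branch false = freeCount≤rank-PARITY T₀ _
  on-branch true  = freeCount≤rank-PARITY T₁ _
  by-query : ∀ s → τ i ≡ s → freeCount τ ≤ rank (node i T₀ T₁)
  by-query (just b) τi = ≤-trans (on-branch b (computesOn-fixed τi T⊢)) (rank-branch≤rank-node i T₀ T₁ b)
  by-query nothing  τi with lighter-branch i T₀ T₁
  ... | b , lighter = begin
    freeCount τ                  ≡⟨ freeCount-fix τ i b τi ⟩
    suc (freeCount (fix τ i b))  ≤⟨ s≤s (on-branch b (computesOn-free b τi T⊢)) ⟩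
    suc (rank (branch T₀ T₁ b))  ≤⟨ lighter ⟩
    rank (node i T₀ T₁)          ∎

-- The rank of TRIBES

sumᶠ : ∀ {n} → (Fin n → ℕ) → ℕ
sumᶠ {zero}  u = 0
sumᶠ {suc n} u = u fzero + sumᶠ (u ∘ fsuc)

sumᶠ-ones : ∀ n → sumᶠ {n} (const 1) ≡ n
sumᶠ-ones zero    = refl
sumᶠ-ones (suc n) = cong suc (sumᶠ-ones n)

sumᶠ-mono : ∀ {n} {u u′ : Fin n → ℕ} → (∀ j → u j ≤ u′ j) → sumᶠ u ≤ sumᶠ u′
sumᶠ-mono {zero}  u≤u′ = z≤n
sumᶠ-mono {suc n} u≤u′ = +-mono-≤ (u≤u′ fzero) (sumᶠ-mono (u≤u′ ∘ fsuc))

sumᶠ-zero-or-pos : ∀ {n} (u : Fin n → ℕ) → sumᶠ u ≡ 0 ⊎ Σ (Fin n) λ j → 1 ≤ u j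
sumᶠ-zero-or-pos {zero}  u = inj₁ refl
sumᶠ-zero-or-pos {suc n} u with u fzero in u0 | sumᶠ-zero-or-pos (u ∘ fsuc)
... | suc _ | _              = inj₂ (fzero , subst (1 ≤_) (sym u0) (s≤s z≤n))
... | zero  | inj₁ none      = inj₁ none
... | zero  | inj₂ (j , u≥1) = inj₂ (fsuc j , u≥1)

sumᶠ-update : ∀ {n} {A : Set} (μ : A → ℕ) (u : Fin n → A) j {a δ} →
  μ (u j) ≤ μ a + δ → sumᶠ (μ ∘ u) ≤ sumᶠ (μ ∘ (u [ j ≔ a ])) + δ
sumᶠ-update μ u fzero {a} {δ} μu≤ = begin
  μ (u fzero) + s   ≤⟨ +-monoˡ-≤ s μu≤ ⟩
  μ a + δ + s       ≡⟨ +-assoc (μ a) δ s ⟩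
  μ a + (δ + s)     ≡⟨ cong (μ a +_) (+-comm δ s) ⟩
  μ a + (s + δ)     ≡⟨ sym (+-assoc (μ a) s δ) ⟩
  μ a + s + δ       ∎
  where
  open ≤-Reasoning
  s = sumᶠ (μ ∘ u ∘ fsuc)
sumᶠ-update μ u (fsuc j) {a} {δ} μu≤ =
  ≤-trans (+-monoʳ-≤ (μ (u fzero)) (sumᶠ-update μ (u ∘ fsuc) j μu≤))
          (≤-reflexive (sym (+-assoc (μ (u fzero)) (sumᶠ (μ ∘ (u ∘ fsuc [ j ≔ a ]))) δ)))

notFalse : Maybe Bool → Bool
notFalse (just false) = false
notFalse _            = true

zeroFree : ∀ {m} → Restriction m → Bool
zeroFree {zero}  τ = true
zeroFree {suc m} τ = notFalse (τ fzero) ∧ zeroFree (τ ∘ fsuc)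

zeroFree-unrestricted : ∀ m → zeroFree (unrestricted {m}) ≡ true
zeroFree-unrestricted zero    = refl
zeroFree-unrestricted (suc m) = zeroFree-unrestricted m

fill-true-zeroFree : ∀ {m} (τ : Restriction m) → zeroFree τ ≡ true → ∀ k → fill true τ k ≡ true
fill-true-zeroFree {suc m} τ zf fzero with τ fzero
... | nothing    = refl
... | just true  = refl
... | just false with () ← zf
fill-true-zeroFree {suc m} τ zf (fsuc k) with notFalse (τ fzero)
... | true  = fill-true-zeroFree (τ ∘ fsuc) zf k
... | false with () ← zf

liveness : Bool → ℕ → ℕ
liveness b (suc (suc _)) = if b then 1 else 0
liveness _ _             = 0

liveness≤1 : ∀ b f → liveness b f ≤ 1
liveness≤1 true  (suc (suc _)) = ≤-refl
liveness≤1 false (suc (suc _)) = z≤n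
liveness≤1 _     zero          = z≤n
liveness≤1 _     (suc zero)    = z≤n

-- A block is live when it has no variable set to 0 and two free ones: the adversary can
-- then still make its AND either 1 or, at the price of one unit of rank, 0.
live : ∀ {m} → Restriction m → ℕ
live τ = liveness (zeroFree τ) (freeCount τ)

live≤1 : ∀ {m} (τ : Restriction m) → live τ ≤ 1
live≤1 τ = liveness≤1 (zeroFree τ) (freeCount τ)

live⇒zeroFree : ∀ {m} (τ : Restriction m) → 1 ≤ live τ → zeroFree τ ≡ true
live⇒zeroFree τ = go (zeroFree τ) (freeCount τ)
  where
  go : ∀ b f → 1 ≤ liveness b f → b ≡ true
  go true (suc (suc _)) _ = refl

live-unrestricted : ∀ {m} → 2 ≤ m → live (unrestricted {m}) ≡ 1
live-unrestricted {m} (s≤s (s≤s _)) rewrite zeroFree-unrestricted m = refl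

live-split : ∀ {m} (τ : Restriction m) k → τ k ≡ nothing →
  live τ ≡ 0 ⊎ Σ (Fin m) λ k′ → fix τ k true k′ ≡ nothing
live-split τ k τk≡∅ with freeCount-zero-or-free (fix τ k true)
... | inj₂ free = inj₂ free
... | inj₁ none = inj₁ (cong (liveness (zeroFree τ)) (trans (freeCount-fix τ k true τk≡∅) (cong suc none)))

module TribesLowerBound (n : ℕ) where

  open Blocks {n} {n}

  Falsifiable : Restriction n → Set
  Falsifiable τ = AND n (fill false τ) ≡ false

  falsifiable-free : ∀ τ k → τ k ≡ nothing → Falsifiable τ
  falsifiable-free τ k τk≡∅ = AND-false n (fill false τ) k (cong (fromMaybe false) τk≡∅)

  falsifiable-fix : ∀ τ k → Falsifiable (fix τ k false)
  falsifiable-fix τ k = AND-false n _ k (cong (fromMaybe false) (updateAt-updates k τ))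

  Potential : BlockRestriction → ℕ
  Potential ρ = sumᶠ (live ∘ ρ)

  Bounded : DTree (n * n) → Set
  Bounded T = ∀ ρ → (∀ j → Falsifiable (ρ j)) → ComputesOnᴮ T (TRIBES n) ρ → Potential ρ ≤ rank T

  -- Filling the free variables with 1 makes a live block, hence TRIBES, true; filling them
  -- with 0 makes every falsifiable block, hence TRIBES, false.
  bounded-leaf : ∀ c → Bounded (leaf c)
  bounded-leaf c ρ falsifiable T⊢ with sumᶠ-zero-or-pos (live ∘ ρ)
  ... | inj₁ none        = ≤-reflexive none
  ... | inj₂ (j , live-j) = ⊥-elim (not-¬ refl (begin
    true         ≡⟨ sym TRIBES-x₁ ⟩
    TRIBES n x₁  ≡⟨ sym (T⊢ x₁ (unblock-⊨ᴮ (λ j → fill-⊨ true (ρ j)))) ⟩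
    c            ≡⟨ T⊢ x₀ (unblock-⊨ᴮ (λ j → fill-⊨ false (ρ j))) ⟩
    TRIBES n x₀  ≡⟨ TRIBES-x₀ ⟩
    false        ∎))
    where
    open ≡-Reasoning
    Z₁ Z₀ : Fin n → Fin n → Bool
    Z₁ j = fill true (ρ j)
    Z₀ j = fill false (ρ j)
    x₁ = unblock Z₁
    x₀ = unblock Z₀
    TRIBES-x₁ : TRIBES n x₁ ≡ true
    TRIBES-x₁ = OR-true n _ j (AND-true n _ λ k →
      trans (block-unblock Z₁ j k) (fill-true-zeroFree (ρ j) (live⇒zeroFree (ρ j) live-j) k))
    TRIBES-x₀ : TRIBES n x₀ ≡ false
    TRIBES-x₀ = OR-false n _ λ j′ → trans (AND-cong n (block-unblock Z₀ j′)) (falsifiable j′)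

  bounded-node : ∀ j k T₀ T₁ → (∀ b → Bounded (branch T₀ T₁ b)) → Bounded (node (combine j k) T₀ T₁)
  bounded-node j k T₀ T₁ on-branch ρ falsifiable T⊢ = by-query (ρ j k) refl
    where
    descend : ∀ b {δ} → ρ j k ≡ nothing → live (ρ j) ≤ live (fix (ρ j) k b) + δ →
      Falsifiable (fix (ρ j) k b) → Potential ρ ≤ rank (branch T₀ T₁ b) + δ
    descend b {δ} ρjk≡∅ live≤ F =
      ≤-trans (sumᶠ-update live ρ j live≤)
              (+-monoˡ-≤ δ (on-branch b (fixᴮ ρ j k b) (≔-preserves {P = Falsifiable} j falsifiable F)
                                      (computesOnᴮ-free b ρjk≡∅ T⊢)))

    by-query : ∀ s → ρ j k ≡ s → Potential ρ ≤ rank (node (combine j k) T₀ T₁)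
    by-query (just b) ρjk≡b =
      ≤-trans (on-branch b ρ falsifiable (computesOnᴮ-fixed ρjk≡b T⊢))
              (rank-branch≤rank-node (combine j k) T₀ T₁ b)
    by-query nothing ρjk≡∅ with live-split (ρ j) k ρjk≡∅
    ... | inj₁ dead =
      ≤-trans (descend false ρjk≡∅ (subst (_≤ live (fix (ρ j) k false) + 0) (sym dead) z≤n)
                       (falsifiable-fix (ρ j) k))
              (≤-trans (≤-reflexive (+-identityʳ _)) (rank-branch≤rank-node (combine j k) T₀ T₁ false))
    ... | inj₂ (k′ , free) with lighter-branch (combine j k) T₀ T₁
    ...   | b , lighter =
      ≤-trans (descend b ρjk≡∅ (≤-trans (live≤1 (ρ j)) (m≤n+m 1 _)) (halves b))
              (≤-trans (≤-reflexive (+-comm _ 1)) lighter)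
      where
      halves : ∀ b → Falsifiable (fix (ρ j) k b)
      halves false = falsifiable-fix (ρ j) k
      halves true  = falsifiable-free (fix (ρ j) k true) k′ free

  bounded : ∀ T → Bounded T
  bounded (leaf c) = bounded-leaf c
  bounded (node i T₀ T₁) with blockIndex i
  ... | at j k = bounded-node j k T₀ T₁ λ { false → bounded T₀ ; true → bounded T₁ }

  rank≥ : 2 ≤ n → ∀ T → Computes T (TRIBES n) → n ≤ rank T
  rank≥ 2≤n T T⊢ = begin
    n                                 ≡⟨ sym (sumᶠ-ones n) ⟩
    sumᶠ {n} (const 1)                ≤⟨ sumᶠ-mono {n} (λ _ → ≤-reflexive (sym (live-unrestricted 2≤n))) ⟩
    Potential (λ _ → unrestricted)    ≤⟨ bounded T _ (λ _ → falsifiable-free unrestricted k₀ refl)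
                                                   (λ x _ → T⊢ x) ⟩
    rank T                            ∎
    where
    open ≤-Reasoning
    k₀ : Fin n
    k₀ = Fin.fromℕ< (≤-trans (s≤s z≤n) 2≤n)

dual : ∀ {N} → DTree N → DTree N
dual (leaf b)       = leaf (not b)
dual (node i t₀ t₁) = node i (dual t₁) (dual t₀)

eval-dual : ∀ {N} (T : DTree N) x → eval (dual T) x ≡ not (eval T (not ∘ x))
eval-dual (leaf b)       x = refl
eval-dual (node i t₀ t₁) x with x i
... | true  = eval-dual t₀ x
... | false = eval-dual t₁ x

rank-dual : ∀ {N} (T : DTree N) → rank (dual T) ≡ rank T
rank-dual (node i t₀ t₁) =
  trans (rank-node i (dual t₁) (dual t₀))
        (trans (cong₂ joinRank (rank-dual t₁) (rank-dual t₀))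
               (trans (joinRank-comm (rank t₁) (rank t₀)) (sym (rank-node i t₀ t₁))))
rank-dual (leaf b) = refl

TRIBESᵈ-dual : ∀ n x → TRIBESᵈ n (not ∘ x) ≡ not (TRIBES n x)
TRIBESᵈ-dual n x =
  trans (AND-cong n (λ j → OR-not n (λ k → x (combine j k)))) (AND-not n (λ j → AND n (λ k → x (combine j k))))

TRIBES-rank≥ : ∀ n T → Computes T (TRIBES (suc n)) → suc n ≤ rank T
TRIBES-rank≥ zero    = nonConstant⇒rank-pos (const false , const true , λ ())
TRIBES-rank≥ (suc n) = TribesLowerBound.rank≥ (suc (suc n)) (s≤s (s≤s z≤n))

TRIBESᵈ-rank≥ : ∀ n T → Computes T (TRIBESᵈ (suc n)) → suc n ≤ rank T
TRIBESᵈ-rank≥ n T T⊢ = subst (suc n ≤_) (rank-dual T) (TRIBES-rank≥ n (dual T) dual⊢)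
  where
  dual⊢ : Computes (dual T) (TRIBES (suc n))
  dual⊢ x = trans (eval-dual T x)
                  (trans (cong not (trans (T⊢ (not ∘ x)) (TRIBESᵈ-dual (suc n) x))) (not-involutive _))

depth-AND : ∀ {n d} → IsDepth (AND n) d → d ≡ n
depth-AND {n} ((S , S⊢ , refl) , d-min) =
  ≤-antisym (≤-trans (d-min (andTree n id) (eval-andTree n id)) (≤-reflexive (depth-andTree n id)))
            (SensitiveAt.arity≤depth (AND-true n (const true) λ _ → refl) (AND-false n) S S⊢)

depth-OR : ∀ {n d} → IsDepth (OR n) d → d ≡ n
depth-OR {n} ((S , S⊢ , refl) , d-min) =
  ≤-antisym (≤-trans (d-min (orTree n id) (eval-orTree n id)) (≤-reflexive (depth-orTree n id)))
            (SensitiveAt.arity≤depth (OR-false n (const false) λ _ → refl) (OR-true n) S S⊢)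

rank-PARITY : ∀ {m r} → IsRank (PARITY m) r → r ≡ m
rank-PARITY {m} ((G , G⊢ , refl) , r-min) =
  ≤-antisym (≤-trans (r-min (parityTree m id leaf) (eval-parityTree m id leaf)) (rank-PARITY≤ m))
            (subst (_≤ rank G) (freeCount-unrestricted m) (freeCount≤rank-PARITY G unrestricted (λ x _ → G⊢ x)))

rank-AND : ∀ {n r} → IsRank (AND (suc n)) r → r ≡ 1
rank-AND {n} ((G , G⊢ , refl) , r-min) =
  ≤-antisym (≤-trans (r-min (andTree (suc n) id) (eval-andTree (suc n) id)) (rank-andTree (suc n) id))
            (nonConstant⇒rank-pos (AND-nonConstant n) G G⊢)

rank-OR : ∀ {n r} → IsRank (OR (suc n)) r → r ≡ 1
rank-OR {n} ((G , G⊢ , refl) , r-min) =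
  ≤-antisym (≤-trans (r-min (orTree (suc n) id) (eval-orTree (suc n) id)) (rank-orTree (suc n) id))
            (nonConstant⇒rank-pos (OR-nonConstant n) G G⊢)

-- Tightness

rank-AND∘PARITY : (n m : ℕ) → 1 ≤ n → 1 ≤ m → (d r R : ℕ) →
  IsDepth (AND n) d → IsRank (PARITY m) r → IsRank (compose (AND n) (PARITY m)) R → R ≡ d * (r ∸ 1) + 1
rank-AND∘PARITY (suc n) (suc m) _ _ d r R d-AND r-PARITY R-comp with depth-AND d-AND | rank-PARITY r-PARITY
... | refl | refl =
  ≤-antisym (≤-trans (proj₂ R-comp (andParityTree (suc n) (suc m) combine)
                                   (eval-andParityTree (suc n) (suc m) combine))
                     (rank-andParityTree (suc n) m combine))
            (rank-compose≥ (AND-nonConstant n) (PARITY-nonConstant m) d-AND r-PARITY R-comp)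

rank-TRIBES : (n : ℕ) → 1 ≤ n → (d r R : ℕ) →
  IsDepth (OR n) d → IsRank (AND n) r → IsRank (TRIBES n) R → R ≡ d * r
rank-TRIBES (suc n) _ d r R d-OR r-AND R-TRIBES@((T , T⊢ , refl) , _) with depth-OR d-OR | rank-AND r-AND
... | refl | refl = ≤-antisym (rank-compose≤ d-OR r-AND R-TRIBES)
                              (subst (_≤ rank T) (sym (*-identityʳ (suc n))) (TRIBES-rank≥ n T T⊢))

rank-TRIBESᵈ : (n : ℕ) → 1 ≤ n → (d r R : ℕ) →
  IsDepth (AND n) d → IsRank (OR n) r → IsRank (TRIBESᵈ n) R → R ≡ d * r
rank-TRIBESᵈ (suc n) _ d r R d-AND r-OR R-TRIBESᵈ@((T , T⊢ , refl) , _) with depth-AND d-AND | rank-OR r-OR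
... | refl | refl = ≤-antisym (rank-compose≤ d-AND r-OR R-TRIBESᵈ)
                              (subst (_≤ rank T) (sym (*-identityʳ (suc n))) (TRIBESᵈ-rank≥ n T T⊢))

theorem6p6 :
  -- the two bounds, for all non-constant f, g
  ((n m : ℕ) (f : BoolFun n) (g : BoolFun m) →
    NonConstant f → NonConstant g →
    (d r R : ℕ) → IsDepth f d → IsRank g r → IsRank (compose f g) R →
    (d * (r ∸ 1) + 1 ≤ R) × (R ≤ d * r))
  ×
  -- tightness of the lower bound for AND_n ∘ PARITY_m
  ((n m : ℕ) → 1 ≤ n → 1 ≤ m →
    (d r R : ℕ) → IsDepth (AND n) d → IsRank (PARITY m) r →
    IsRank (compose (AND n) (PARITY m)) R →
    R ≡ d * (r ∸ 1) + 1)
  ×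
  -- tightness of the upper bound for TRIBES_n = OR_n ∘ AND_n
  ((n : ℕ) → 1 ≤ n →
    (d r R : ℕ) → IsDepth (OR n) d → IsRank (AND n) r →
    IsRank (TRIBES n) R →
    R ≡ d * r)
  ×
  -- and for its dual TRIBES^d_n = AND_n ∘ OR_n
  ((n : ℕ) → 1 ≤ n →
    (d r R : ℕ) → IsDepth (AND n) d → IsRank (OR n) r →
    IsRank (TRIBESᵈ n) R →
    R ≡ d * r)
theorem6p6 =
  (λ n m f g f≠ g≠ d r R d-f r-g R-fg → rank-compose≥ f≠ g≠ d-f r-g R-fg , rank-compose≤ d-f r-g R-fg) ,
  rank-AND∘PARITY , rank-TRIBES , rank-TRIBESᵈ
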